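{- Let $G$ be an $(S_{1,2,5},S_{3,3,3})$-free chordal bipartite graph with edge set $E$, let $D$ be an efficient dominating set of $G$, and let $P=(u_1,v_1,u_2,v_2,u_3)$ be an induced path $P_5$ in $G$ with $D\cap V(P)=\emptyset$. If $u_1$ and $u_3$ have a common neighbour $v\in D$, then $u_2v\in E$, and $v_1$ and $v_2$ have no common neighbour in $D$.
   Context: All graphs are finite, simple and undirected. A set $D\subseteq V(G)$ is an efficient dominating set of $G$ if $|D\cap N[w]|=1$ for every vertex $w$, where $N[w]$ is the closed neighbourhood of $w$. For $i,j,k\ge0$, $S_{i,j,k}$ is the tree formed by a center $u$ and three induced paths from $u$ with $i$, $j$, $k$ further vertices respectively, pairwise sharing only $u$. A bipartite graph is chordal bipartite if it has no induced cycle $C_{2k}$ with $k\ge3$. -}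

module Defs where

open import Data.Nat using (ℕ; zero; suc; _≤_; _*_; _∸_)
open import Data.Fin using (Fin; toℕ; _≟_)
open import Data.Fin.Subset using (Subset; _∈_; _∩_; ∣_∣)
open import Data.Bool using (Bool; true; false; _∨_)
open import Data.Vec using (tabulate)
open import Data.Product using (Σ; _×_; ∃; ∃-syntax)
open import Relation.Nullary using (¬_; does)
open import Relation.Binary.PropositionalEquality using (_≡_; _≢_)
open import Function.Definitions using (Injective)

record SimpleGraph (n : ℕ) : Set where
  field
    adj    : Fin n → Fin n → Bool
    sym    : ∀ x y → adj x y ≡ adj y x
    irrefl : ∀ x → adj x x ≡ false

open SimpleGraph public

Edge : ∀ {n} → SimpleGraph n → Fin n → Fin n → Set
Edge G x y = adj G x y ≡ true

closedNbhd : ∀ {n} → SimpleGraph n → Fin n → Subset n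
closedNbhd G w = tabulate (λ x → does (x ≟ w) ∨ adj G w x)

EfficientDominating : ∀ {n} → SimpleGraph n → Subset n → Set
EfficientDominating {n} G D = ∀ (w : Fin n) → ∣ D ∩ closedNbhd G w ∣ ≡ 1

InducedCopy : ∀ {n} (V : Set) (HAdj : V → V → Set) → SimpleGraph n → Set
InducedCopy {n} V HAdj G =
  Σ (V → Fin n) λ f → Injective _≡_ _≡_ f ×
    (∀ a b → (HAdj a b → Edge G (f a) (f b)) × (Edge G (f a) (f b) → HAdj a b))

-- The tree S_{i,j,k}: a centre and three legs; leg t has (l t) further vertices,
-- indexed 0,1,...; vertex 0 of each leg is adjacent to the centre.
data SVert (l : Fin 3 → ℕ) : Set where
  centre : SVert l
  leg    : (t : Fin 3) → Fin (l t) → SVert l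

data SAdj (l : Fin 3 → ℕ) : SVert l → SVert l → Set where
  c-l : ∀ t (a : Fin (l t)) → toℕ a ≡ 0 → SAdj l centre (leg t a)
  l-c : ∀ t (a : Fin (l t)) → toℕ a ≡ 0 → SAdj l (leg t a) centre
  l-l : ∀ t (a b : Fin (l t)) → suc (toℕ a) ≡ toℕ b → SAdj l (leg t a) (leg t b)
  l-l' : ∀ t (a b : Fin (l t)) → toℕ a ≡ suc (toℕ b) → SAdj l (leg t a) (leg t b)

legs : ℕ → ℕ → ℕ → Fin 3 → ℕ
legs i j k Fin.zero = i
legs i j k (Fin.suc Fin.zero) = j
legs i j k (Fin.suc (Fin.suc Fin.zero)) = k

SFree : ∀ {n} → ℕ → ℕ → ℕ → SimpleGraph n → Set
SFree i j k G = ¬ InducedCopy (SVert (legs i j k)) (SAdj (legs i j k)) G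

data CAdj (m : ℕ) : Fin m → Fin m → Set where
  step  : ∀ a b → suc (toℕ a) ≡ toℕ b → CAdj m a b
  step' : ∀ a b → toℕ a ≡ suc (toℕ b) → CAdj m a b
  wrap  : ∀ a b → toℕ a ≡ m ∸ 1 → toℕ b ≡ 0 → CAdj m a b
  wrap' : ∀ a b → toℕ a ≡ 0 → toℕ b ≡ m ∸ 1 → CAdj m a b

Bipartite : ∀ {n} → SimpleGraph n → Set
Bipartite {n} G = Σ (Fin n → Bool) λ c → ∀ x y → Edge G x y → c x ≢ c y

ChordalBipartite : ∀ {n} → SimpleGraph n → Set
ChordalBipartite G =
  Bipartite G × (∀ k → 3 ≤ k → ¬ InducedCopy (Fin (2 * k)) (CAdj (2 * k)) G)

InducedP5 : ∀ {n} → SimpleGraph n → Fin n → Fin n → Fin n → Fin n → Fin n → Set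
InducedP5 G u1 v1 u2 v2 u3 =
  (u1 ≢ v1 × u1 ≢ u2 × u1 ≢ v2 × u1 ≢ u3 × v1 ≢ u2 × v1 ≢ v2 × v1 ≢ u3 ×
   u2 ≢ v2 × u2 ≢ u3 × v2 ≢ u3) ×
  (Edge G u1 v1 × Edge G v1 u2 × Edge G u2 v2 × Edge G v2 u3) ×
  (¬ Edge G u1 u2 × ¬ Edge G u1 v2 × ¬ Edge G u1 u3 ×
   ¬ Edge G v1 v2 × ¬ Edge G v1 u3 × ¬ Edge G u2 u3)

-- Both claims come from one fact about chordal bipartite graphs: if the two
-- ends of an induced P5 have a common neighbour x, then x is adjacent to the
-- middle vertex, since otherwise the path and x form an induced C6 (the other
-- non-adjacencies are forced by bipartiteness). Applied to u1 v1 u2 v2 u3 and v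
-- this gives u2v ∈ E. A common neighbour w ∈ D of v1 and v2 closes the induced
-- path v1 u1 v u3 v2, so it would be adjacent to v, but two vertices of an
-- efficient dominating set are never adjacent.
module Submission where

open import Defs hiding (sym)
open import Data.Nat using (ℕ; suc; _∸_) renaming (_≟_ to _≟ℕ_)
open import Data.Nat.Properties using (≤-refl; <-irrefl)
open import Data.Fin using (Fin; toℕ; _≟_)
open import Data.Fin.Patterns using (0F; 1F; 2F; 3F; 4F; 5F)
open import Data.Fin.Subset using (Subset; _∈_; _∉_; _⊆_; ⁅_⁆; ∣_∣)
open import Data.Fin.Subset.Properties using (x∈⁅y⁆⇒x≡y; ∣⁅x⁆∣≡1; p⊂q⇒∣p∣<∣q∣; x∈p∩q⁺)
open import Data.Fin.Properties using (all?)
open import Data.Vec using (Vec; []; _∷_; lookup)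
open import Data.Vec.Properties using (lookup⇒[]=; lookup∘tabulate)
open import Data.Bool using (Bool; true; _∨_) renaming (_≟_ to _≟𝔹_)
open import Data.Bool.Properties using (¬-not; ∨-zeroʳ; T-≡)
open import Data.Product using (∃-syntax; _×_; _,_; proj₁)
open import Data.Sum using (_⊎_; inj₁; inj₂)
open import Function.Base using (_∘_)
open import Function.Bundles using (Equivalence)
open import Function.Definitions using (Injective)
open import Relation.Binary.Definitions using (Decidable)
open import Relation.Binary.PropositionalEquality using (_≡_; _≢_; refl; sym; trans; cong; subst)
open import Relation.Nullary using (¬_; does)
open import Relation.Nullary.Decidable
  using (map′; _⊎-dec_; _×-dec_; _→-dec_; dec-true; isYes≗does; toWitness; from-yes; decidable-stable)

∣p∣≡1⇒x∈p⇒y∈p⇒x≡y : ∀ {n} {p : Subset n} {x y : Fin n} → ∣ p ∣ ≡ 1 → x ∈ p → y ∈ p → x ≡ y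
∣p∣≡1⇒x∈p⇒y∈p⇒x≡y {p = p} {x} {y} ∣p∣≡1 x∈p y∈p = decidable-stable (x ≟ y) λ x≢y →
  <-irrefl (trans (∣⁅x⁆∣≡1 x) (sym ∣p∣≡1))
    (p⊂q⇒∣p∣<∣q∣ (⁅x⁆⊆p , y , y∈p , λ y∈⁅x⁆ → x≢y (sym (x∈⁅y⁆⇒x≡y x y∈⁅x⁆))))
  where
  ⁅x⁆⊆p : ⁅ x ⁆ ⊆ p
  ⁅x⁆⊆p z∈⁅x⁆ = subst (_∈ p) (sym (x∈⁅y⁆⇒x≡y x z∈⁅x⁆)) x∈p

CAdj? : ∀ m → Decidable (CAdj m)
CAdj? m a b = map′ fromCases toCases
  (suc (toℕ a) ≟ℕ toℕ b ⊎-dec toℕ a ≟ℕ suc (toℕ b) ⊎-dec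
   (toℕ a ≟ℕ m ∸ 1 ×-dec toℕ b ≟ℕ 0) ⊎-dec (toℕ a ≟ℕ 0 ×-dec toℕ b ≟ℕ m ∸ 1))
  where
  Cases : Set
  Cases = suc (toℕ a) ≡ toℕ b ⊎ toℕ a ≡ suc (toℕ b) ⊎
          (toℕ a ≡ m ∸ 1 × toℕ b ≡ 0) ⊎ (toℕ a ≡ 0 × toℕ b ≡ m ∸ 1)

  fromCases : Cases → CAdj m a b
  fromCases (inj₁ p)                    = step a b p
  fromCases (inj₂ (inj₁ p))             = step' a b p
  fromCases (inj₂ (inj₂ (inj₁ (p , q)))) = wrap a b p q
  fromCases (inj₂ (inj₂ (inj₂ (p , q)))) = wrap' a b p q

  toCases : CAdj m a b → Cases
  toCases (step _ _ p)    = inj₁ p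
  toCases (step' _ _ p)   = inj₂ (inj₁ p)
  toCases (wrap _ _ p q)  = inj₂ (inj₂ (inj₁ (p , q)))
  toCases (wrap' _ _ p q) = inj₂ (inj₂ (inj₂ (p , q)))

C6-twinFree : ∀ a b → (∀ c → does (CAdj? 6 c a) ≡ does (CAdj? 6 c b)) → a ≡ b
C6-twinFree = from-yes (all? λ a → all? λ b →
  all? (λ c → does (CAdj? 6 c a) ≟𝔹 does (CAdj? 6 c b)) →-dec a ≟ b)

module _ {n : ℕ} (G : SimpleGraph n) where

  private variable
    w x y : Fin n
    β : Bool

  adj-swap : adj G x y ≡ β → adj G y x ≡ β
  adj-swap {x} {y} = trans (SimpleGraph.sym G y x)

  Edge⇒≢ : Edge G x y → x ≢ y
  Edge⇒≢ {x} xy refl with trans (sym xy) (irrefl G x)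
  ... | ()

  Bipartite⇒commonNeighbour⇒¬Edge : Bipartite G → Edge G x w → Edge G y w → ¬ Edge G x y
  Bipartite⇒commonNeighbour⇒¬Edge {x = x} {w = w} {y = y} (_ , proper) xw yw xy =
    proper x y xy (trans (¬-not (proper x w xw)) (sym (¬-not (proper y w yw))))

  w∈N[w] : w ∈ closedNbhd G w
  w∈N[w] {w} = lookup⇒[]= w _ (trans (lookup∘tabulate _ w) w≟w∨w~w)
    where
    w≟w∨w~w : does (w ≟ w) ∨ adj G w w ≡ true
    w≟w∨w~w rewrite dec-true (w ≟ w) refl = refl

  Edge⇒∈N[w] : Edge G w x → x ∈ closedNbhd G w
  Edge⇒∈N[w] {w} {x} wx =
    lookup⇒[]= x _ (trans (lookup∘tabulate _ x) (trans (cong (does (x ≟ w) ∨_) wx) (∨-zeroʳ _)))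

  EfficientDominating⇒independent : {D : Subset n} → EfficientDominating G D →
    x ∈ D → y ∈ D → ¬ Edge G x y
  EfficientDominating⇒independent {x = x} efficient x∈D y∈D xy = Edge⇒≢ xy
    (∣p∣≡1⇒x∈p⇒y∈p⇒x≡y (efficient x) (x∈p∩q⁺ (x∈D , w∈N[w])) (x∈p∩q⁺ (y∈D , Edge⇒∈N[w] xy)))

  -- In a twin-free pattern a vertex is determined by its neighbourhood, so a
  -- map matching adjacency tables is automatically injective.
  InducedCopy-fromTable : {V : Set} {HAdj : V → V → Set} (HAdj? : Decidable HAdj) →
    (∀ a b → (∀ c → does (HAdj? c a) ≡ does (HAdj? c b)) → a ≡ b) →
    (f : V → Fin n) → (∀ a b → adj G (f a) (f b) ≡ does (HAdj? a b)) →
    InducedCopy V HAdj G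
  InducedCopy-fromTable {HAdj = HAdj} HAdj? twinFree f table =
    f , injective , λ a b → preserves a b , reflects a b
    where
    injective : Injective _≡_ _≡_ f
    injective {a} {b} fa≡fb = twinFree a b λ c →
      trans (sym (table c a)) (trans (cong (adj G (f c)) fa≡fb) (table c b))

    preserves : ∀ a b → HAdj a b → Edge G (f a) (f b)
    preserves a b ab = trans (table a b) (dec-true (HAdj? a b) ab)

    reflects : ∀ a b → Edge G (f a) (f b) → HAdj a b
    reflects a b fafb = toWitness {a? = HAdj? a b}
      (Equivalence.from T-≡ (trans (isYes≗does (HAdj? a b)) (trans (sym (table a b)) fafb)))

  InducedP5+commonNeighbour⇒C6 : ∀ {a b c d e x} → InducedP5 G a b c d e →
    Edge G a x → Edge G e x → ¬ Edge G b x → ¬ Edge G c x → ¬ Edge G d x →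
    InducedCopy (Fin 6) (CAdj 6) G
  InducedP5+commonNeighbour⇒C6 {a} {b} {c} {d} {e} {x}
    (_ , (ab , bc , cd , de) , (¬ac , ¬ad , ¬ae , ¬bd , ¬be , ¬ce)) ax ex ¬bx ¬cx ¬dx =
    InducedCopy-fromTable (CAdj? 6) C6-twinFree (lookup hexagon) table
    where
    hexagon : Vec (Fin n) 6
    hexagon = a ∷ b ∷ c ∷ d ∷ e ∷ x ∷ []

    table : ∀ i j → adj G (lookup hexagon i) (lookup hexagon j) ≡ does (CAdj? 6 i j)
    table 0F 0F = irrefl G a
    table 0F 1F = ab
    table 0F 2F = ¬-not ¬ac
    table 0F 3F = ¬-not ¬ad
    table 0F 4F = ¬-not ¬ae
    table 0F 5F = ax
    table 1F 0F = adj-swap ab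
    table 1F 1F = irrefl G b
    table 1F 2F = bc
    table 1F 3F = ¬-not ¬bd
    table 1F 4F = ¬-not ¬be
    table 1F 5F = ¬-not ¬bx
    table 2F 0F = adj-swap (¬-not ¬ac)
    table 2F 1F = adj-swap bc
    table 2F 2F = irrefl G c
    table 2F 3F = cd
    table 2F 4F = ¬-not ¬ce
    table 2F 5F = ¬-not ¬cx
    table 3F 0F = adj-swap (¬-not ¬ad)
    table 3F 1F = adj-swap (¬-not ¬bd)
    table 3F 2F = adj-swap cd
    table 3F 3F = irrefl G d
    table 3F 4F = de
    table 3F 5F = ¬-not ¬dx
    table 4F 0F = adj-swap (¬-not ¬ae)
    table 4F 1F = adj-swap (¬-not ¬be)
    table 4F 2F = adj-swap (¬-not ¬ce)
    table 4F 3F = adj-swap de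
    table 4F 4F = irrefl G e
    table 4F 5F = ex
    table 5F 0F = adj-swap ax
    table 5F 1F = adj-swap (¬-not ¬bx)
    table 5F 2F = adj-swap (¬-not ¬cx)
    table 5F 3F = adj-swap (¬-not ¬dx)
    table 5F 4F = adj-swap ex
    table 5F 5F = irrefl G x

  ChordalBipartite⇒P5-middle-adjacent : ∀ {a b c d e x} → ChordalBipartite G →
    InducedP5 G a b c d e → Edge G a x → Edge G e x → Edge G c x
  ChordalBipartite⇒P5-middle-adjacent {c = c} {x = x}
    (bipartite , noLongCycle) p5@(_ , (ab , _ , _ , de) , _) ax ex =
    decidable-stable (adj G c x ≟𝔹 true) λ ¬cx →
      noLongCycle 3 ≤-refl (InducedP5+commonNeighbour⇒C6 p5 ax ex
        (Bipartite⇒commonNeighbour⇒¬Edge bipartite (adj-swap ab) (adj-swap ax)) ¬cx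
        (Bipartite⇒commonNeighbour⇒¬Edge bipartite de (adj-swap ex)))

  InducedP5-through-commonNeighbour : ∀ {u1 v1 u2 v2 u3 v} → Bipartite G →
    InducedP5 G u1 v1 u2 v2 u3 → Edge G u1 v → Edge G u3 v → InducedP5 G v1 u1 v u3 v2
  InducedP5-through-commonNeighbour {v1 = v1} {v2 = v2} {v = v} bipartite
    ((u1≢v1 , _ , u1≢v2 , u1≢u3 , _ , v1≢v2 , v1≢u3 , _ , _ , v2≢u3) ,
     (u1v1 , _ , _ , v2u3) , (_ , ¬u1v2 , ¬u1u3 , ¬v1v2 , ¬v1u3 , _)) u1v u3v =
    ( (u1≢v1 ∘ sym , v1≢v , v1≢u3 , v1≢v2 , Edge⇒≢ u1v , u1≢u3 , u1≢v2 , Edge⇒≢ (adj-swap u3v) ,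
       v≢v2 , v2≢u3 ∘ sym)
    , (adj-swap u1v1 , u1v , adj-swap u3v , adj-swap v2u3)
    , (¬v1v , ¬v1u3 , ¬v1v2 , ¬u1u3 , ¬u1v2 , ¬vv2))
    where
    v1≢v : v1 ≢ v
    v1≢v refl = ¬v1u3 (adj-swap u3v)

    v≢v2 : v ≢ v2
    v≢v2 refl = ¬u1v2 u1v

    ¬v1v : ¬ Edge G v1 v
    ¬v1v = Bipartite⇒commonNeighbour⇒¬Edge bipartite (adj-swap u1v1) (adj-swap u1v)

    ¬vv2 : ¬ Edge G v v2
    ¬vv2 = Bipartite⇒commonNeighbour⇒¬Edge bipartite (adj-swap u3v) v2u3

lemma2 : ∀ {n} (G : SimpleGraph n) (D : Subset n) →
    SFree 1 2 5 G → SFree 3 3 3 G → ChordalBipartite G →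
    EfficientDominating G D →
    ∀ (u1 v1 u2 v2 u3 : Fin n) → InducedP5 G u1 v1 u2 v2 u3 →
    u1 ∉ D → v1 ∉ D → u2 ∉ D → v2 ∉ D → u3 ∉ D →
    ∀ (v : Fin n) → v ∈ D → Edge G u1 v → Edge G u3 v →
    Edge G u2 v × ¬ (∃[ w ] (w ∈ D × Edge G v1 w × Edge G v2 w))
lemma2 G D _ _ chordalBipartite efficient u1 v1 u2 v2 u3 p5 _ _ _ _ _ v v∈D u1v u3v =
  ChordalBipartite⇒P5-middle-adjacent G chordalBipartite p5 u1v u3v , noCommonDominator
  where
  noCommonDominator : ¬ (∃[ w ] (w ∈ D × Edge G v1 w × Edge G v2 w))
  noCommonDominator (w , w∈D , v1w , v2w) =
    EfficientDominating⇒independent G efficient v∈D w∈D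
      (ChordalBipartite⇒P5-middle-adjacent G chordalBipartite
        (InducedP5-through-commonNeighbour G {u2 = u2} (proj₁ chordalBipartite) p5 u1v u3v) v1w v2w)
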